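{- Let $k\ge1$ and $n\ge 2k+1$. Distinct sets in $\mathcal V_n^{k,+}$ have distinct cores.
   Context: $\mathcal V_n^k$ denotes the set of $k$-element subsets of $[n]=\{1,\dots,n\}$ independent in the cycle $C_n$ (no two elements cyclically consecutive, $n$ and $1$ being consecutive). For $A\in\mathcal V_n^k$, $\mathrm{core}(A)=A\setminus\{1\}$ if $1\in A$ and $\mathrm{core}(A)=A\setminus\{\max A\}$ otherwise. For $0\le i\le n/2$ let $\Lambda_{n,i}=\{2,4,\dots,i-1\}\cup\{n-i+1,n-i+3,\dots,n\}$ if $i$ is odd and $\Lambda_{n,i}=\{1,3,\dots,i-1\}\cup\{n-i+1,n-i+3,\dots,n-1\}$ if $i$ is even; the $n$-level $\ell_n(A)$ of $A$ is the largest $i$ with $\Lambda_{n,i}\subseteq A$, and $\mathcal V_n^{k,+}=\{A\in\mathcal V_n^k:\ell_n(A)\ge1\}$. -}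

module Defs where

open import Data.Nat using (ℕ; zero; suc; _+_; _*_; _∸_; _≤_; _<_; _/_)
open import Data.Nat.Divisibility using (_∣_)
open import Data.Bool using (Bool; true; false; if_then_else_)
open import Data.Fin using (Fin; toℕ)
open import Data.Fin.Subset using (Subset; _∈_; ∣_∣; inside; outside)
open import Data.Vec using (Vec; []; _∷_)
open import Data.Product using (Σ; _×_; ∃)
open import Data.Sum using (_⊎_)
open import Relation.Binary.PropositionalEquality using (_≡_)
open import Relation.Nullary using (¬_)

-- Subsets of [n] = {1,…,n} are represented as  Subset n  (Vec Bool n);
-- position i : Fin n represents the element  toℕ i + 1.

_∈[_]_ : ℕ → (n : ℕ) → Subset n → Set
m ∈[ n ] A = Σ (Fin n) λ i → (suc (toℕ i) ≡ m) × (i ∈ A)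

CycAdj : ℕ → ℕ → ℕ → Set
CycAdj n a b = (b ≡ suc a) ⊎ ((a ≡ n) × (b ≡ 1))

IndepCycle : (n : ℕ) → Subset n → Set
IndepCycle n A = ∀ a b → a ∈[ n ] A → b ∈[ n ] A → ¬ CycAdj n a b

InV : (n k : ℕ) → Subset n → Set
InV n k A = (∣ A ∣ ≡ k) × IndepCycle n A

-- Λ_{n,i} as a predicate on ℕ (m ∈ Λ_{n,i}).
-- i odd : {2,4,…,i-1} ∪ {n-i+1, n-i+3, …, n}
-- i even: {1,3,…,i-1} ∪ {n-i+1, n-i+3, …, n-1}
InΛ : (n i m : ℕ) → Set
InΛ n i m =
  (¬ (2 ∣ i) →
     ((2 ∣ m) × (2 ≤ m) × (m ≤ i ∸ 1))
   ⊎ ((n ∸ i + 1 ≤ m) × (m ≤ n) × (2 ∣ (n ∸ m))))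
  × ((2 ∣ i) →
     (¬ (2 ∣ m) × (1 ≤ m) × (m ≤ i ∸ 1))
   ⊎ ((n ∸ i + 1 ≤ m) × (m ≤ n ∸ 1) × (2 ∣ (n ∸ 1 ∸ m))))

ΛSub : (n i : ℕ) → Subset n → Set
ΛSub n i A = ∀ m → InΛ n i m → m ∈[ n ] A

-- ℓ_n(A) ≥ 1 : the largest i ∈ [0, n/2] with Λ_{n,i} ⊆ A is ≥ 1, i.e.
-- some i with 1 ≤ i ≤ n/2 has Λ_{n,i} ⊆ A.
LevelPos : (n : ℕ) → Subset n → Set
LevelPos n A = Σ ℕ λ i → (1 ≤ i) × (2 * i ≤ n) × ΛSub n i A

InVplus : (n k : ℕ) → Subset n → Set
InVplus n k A = InV n k A × LevelPos n A

nonEmpty : ∀ {n} → Subset n → Bool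
nonEmpty [] = false
nonEmpty (true ∷ v) = true
nonEmpty (false ∷ v) = nonEmpty v

-- A \ {max A}  (removes the last true entry; identity on the empty set)
removeMax : ∀ {n} → Subset n → Subset n
removeMax [] = []
removeMax (b ∷ v) = if nonEmpty v then b ∷ removeMax v else outside ∷ v

core : ∀ {n} → Subset n → Subset n
core [] = []
core (true ∷ v) = outside ∷ v
core (false ∷ v) = removeMax (false ∷ v)

-- A set of positive level contains either n, or both 1 and n − 1.  If A and B
-- both contain 1, their cores are A ∖ {1} and B ∖ {1}; if neither does, both
-- contain n = max and their cores are A ∖ {n} and B ∖ {n}.  If 1 ∈ A and 1 ∉ B,
-- independence forces n ∉ A, hence n − 1 ∈ A ∖ {1} = core A = core B ⊆ B,
-- while n ∈ B: two consecutive elements of B.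
module Submission where

open import Defs
open import Data.Nat using (ℕ; zero; suc; _≤_; _+_; _*_; _∸_; pred; z≤n; s≤s)
open import Data.Nat.Properties
  using (≤-refl; ≤-trans; ≤-reflexive; ≤-pred; +-monoʳ-≤; +-monoˡ-≤; *-monoʳ-≤; m≤m+n; m∸n+n≡m; n∸n≡0)
open import Data.Nat.Divisibility using (_∣_; _∣?_; _∣0; ∣⇒≤)
open import Data.Fin using (Fin) renaming (zero to fzero; suc to fsuc)
open import Data.Fin.Subset using (Subset; _∈_)
open import Data.Vec using ([]; _∷_; _∷ʳ_; here; there)
open import Data.Vec.Properties using (∷-injectiveʳ; ∷ʳ-injectiveˡ)
open import Data.Bool using (Bool; true; false)
open import Data.Product using (Σ-syntax; _×_; _,_)
open import Data.Sum using (_⊎_; inj₁; inj₂)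
open import Data.Empty using (⊥-elim)
open import Relation.Nullary using (¬_; yes; no; contradiction)
open import Relation.Binary.PropositionalEquality using (_≡_; _≢_; refl; sym; cong; subst)

private
  variable
    m n : ℕ
    b c : Bool

∈-∷⁺ : {v : Subset n} → m ∈[ n ] v → suc m ∈[ suc n ] (b ∷ v)
∈-∷⁺ (i , refl , i∈v) = fsuc i , refl , there i∈v

∈-∷⁻ : {v : Subset n} → suc (suc m) ∈[ suc n ] (b ∷ v) → suc m ∈[ n ] v
∈-∷⁻ (fsuc i , refl , there i∈v) = i , refl , i∈v

1∈-∷⇒head : {v : Subset n} → 1 ∈[ suc n ] (b ∷ v) → b ≡ true
1∈-∷⇒head (fzero , _ , here) = refl

∈-∷-changeHead : {v : Subset n} → 2 ≤ m → m ∈[ suc n ] (b ∷ v) → m ∈[ suc n ] (c ∷ v)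
∈-∷-changeHead (s≤s ()) (fzero , refl , _)
∈-∷-changeHead _ (fsuc i , eq , there i∈v) = fsuc i , eq , there i∈v

removeMax-⊆ : (v : Subset n) {i : Fin n} → i ∈ removeMax v → i ∈ v
removeMax-⊆ (b ∷ v) i∈ with nonEmpty v | i∈
... | true  | here        = here
... | true  | there i∈rv = there (removeMax-⊆ v i∈rv)
... | false | there i∈v  = there i∈v

core-⊆ : (A : Subset n) → m ∈[ n ] core A → m ∈[ n ] A
core-⊆ (true ∷ v)  (fsuc i , eq , there i∈v) = fsuc i , eq , there i∈v
core-⊆ (false ∷ v) (i , eq , i∈) = i , eq , removeMax-⊆ (false ∷ v) i∈

max∈⇒∷ʳ-true : (v : Subset (suc n)) → suc n ∈[ suc n ] v → Σ[ u ∈ Subset n ] v ≡ u ∷ʳ true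
max∈⇒∷ʳ-true {zero}  (true ∷ []) (fzero , refl , here) = [] , refl
max∈⇒∷ʳ-true {suc n} (b ∷ v) n∈ with max∈⇒∷ʳ-true v (∈-∷⁻ n∈)
... | u , refl = b ∷ u , refl

nonEmpty-∷ʳ-true : (u : Subset n) → nonEmpty (u ∷ʳ true) ≡ true
nonEmpty-∷ʳ-true []          = refl
nonEmpty-∷ʳ-true (true ∷ u)  = refl
nonEmpty-∷ʳ-true (false ∷ u) = nonEmpty-∷ʳ-true u

removeMax-∷ʳ-true : (u : Subset n) → removeMax (u ∷ʳ true) ≡ u ∷ʳ false
removeMax-∷ʳ-true []      = refl
removeMax-∷ʳ-true (b ∷ u) rewrite nonEmpty-∷ʳ-true u =
  cong (b ∷_) (removeMax-∷ʳ-true u)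

removeMax-injective-onMax∈ : (A B : Subset (suc n)) →
  suc n ∈[ suc n ] A → suc n ∈[ suc n ] B → removeMax A ≡ removeMax B → A ≡ B
removeMax-injective-onMax∈ A B n∈A n∈B eq
  with max∈⇒∷ʳ-true A n∈A | max∈⇒∷ʳ-true B n∈B
... | u , refl | w , refl
  rewrite removeMax-∷ʳ-true u | removeMax-∷ʳ-true w
  = cong (_∷ʳ true) (∷ʳ-injectiveˡ u w eq)

2∤1 : ¬ (2 ∣ 1)
2∤1 2∣1 with ∣⇒≤ 2∣1
... | s≤s ()

∸+1≤ : ∀ {i} → 1 ≤ i → i ≤ n → n ∸ i + 1 ≤ n
∸+1≤ {n} {i} 1≤i i≤n = ≤-trans (+-monoʳ-≤ (n ∸ i) 1≤i) (≤-reflexive (m∸n+n≡m i≤n))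

max∈Λ-odd : ∀ {i} → ¬ (2 ∣ i) → 1 ≤ i → i ≤ n → InΛ n i n
max∈Λ-odd {n} i-odd 1≤i i≤n =
    (λ _ → inj₂ (∸+1≤ 1≤i i≤n , ≤-refl , subst (2 ∣_) (sym (n∸n≡0 n)) (2 ∣0)))
  , (λ i-even → contradiction i-even i-odd)

1∈Λ-even : ∀ {i} → 2 ∣ (2 + i) → InΛ n (2 + i) 1
1∈Λ-even i-even =
  (λ i-odd → contradiction i-even i-odd) , (λ _ → inj₁ (2∤1 , ≤-refl , s≤s z≤n))

pred∈Λ-even : ∀ {i} → 2 ∣ (2 + i) → 1 + i ≤ n → InΛ (suc n) (2 + i) n
pred∈Λ-even {n} i-even i<n =
    (λ i-odd → contradiction i-even i-odd)
  , (λ _ → inj₂ (∸+1≤ (s≤s z≤n) i<n , ≤-refl , subst (2 ∣_) (sym (n∸n≡0 n)) (2 ∣0)))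

levelPos⇒ends : (A : Subset n) → LevelPos n A →
  n ∈[ n ] A ⊎ (1 ∈[ n ] A × pred n ∈[ n ] A)
levelPos⇒ends {n} A (i , 1≤i , 2i≤n , Λ⊆A) with 2 ∣? i
... | no i-odd = inj₁ (Λ⊆A n (max∈Λ-odd i-odd 1≤i (≤-trans (m≤m+n i (i + 0)) 2i≤n)))
levelPos⇒ends {n} A (suc zero , _ , _ , _) | yes i-even = contradiction i-even 2∤1
levelPos⇒ends {suc n} A (suc (suc i) , _ , 2i≤n , Λ⊆A) | yes i-even =
  inj₂ (Λ⊆A 1 (1∈Λ-even i-even) , Λ⊆A n (pred∈Λ-even i-even i<n))
  where
    i<n : suc i ≤ n
    i<n = ≤-pred (≤-trans (m≤m+n (suc (suc i)) _) 2i≤n)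

levelPos∧1∉⇒max∈ : (v : Subset n) → LevelPos (suc n) (false ∷ v) →
  suc n ∈[ suc n ] (false ∷ v)
levelPos∧1∉⇒max∈ v lev with levelPos⇒ends (false ∷ v) lev
... | inj₁ n∈       = n∈
... | inj₂ (1∈ , _) with () ← 1∈-∷⇒head 1∈

core-distinct-1∈-1∉ : 2 ≤ n → (A B : Subset n) →
  IndepCycle (suc n) (true ∷ A) → LevelPos (suc n) (true ∷ A) →
  IndepCycle (suc n) (false ∷ B) → LevelPos (suc n) (false ∷ B) →
  core (true ∷ A) ≢ core (false ∷ B)
core-distinct-1∈-1∉ {n} 2≤n A B indA levA indB levB eq
  with levelPos⇒ends (true ∷ A) levA
... | inj₁ n∈A = indA _ 1 n∈A (fzero , refl , here) (inj₂ (refl , refl))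
... | inj₂ (_ , pred∈A) = indB _ _ pred∈B n∈B (inj₁ refl)
  where
    n∈B : suc n ∈[ suc n ] (false ∷ B)
    n∈B = levelPos∧1∉⇒max∈ B levB
    pred∈B : n ∈[ suc n ] (false ∷ B)
    pred∈B = core-⊆ (false ∷ B)
               (subst (_ ∈[ _ ]_) eq (∈-∷-changeHead 2≤n pred∈A))

core-injective : 3 ≤ n → (A B : Subset n) →
  IndepCycle n A → LevelPos n A → IndepCycle n B → LevelPos n B →
  core A ≡ core B → A ≡ B
core-injective (s≤s _) (true ∷ A) (true ∷ B) _ _ _ _ eq = cong (true ∷_) (∷-injectiveʳ eq)
core-injective (s≤s 2≤n) (true ∷ A) (false ∷ B) indA levA indB levB eq =
  ⊥-elim (core-distinct-1∈-1∉ 2≤n A B indA levA indB levB eq)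
core-injective (s≤s 2≤n) (false ∷ A) (true ∷ B) indA levA indB levB eq =
  ⊥-elim (core-distinct-1∈-1∉ 2≤n B A indB levB indA levA (sym eq))
core-injective (s≤s _) (false ∷ A) (false ∷ B) _ levA _ levB eq =
  removeMax-injective-onMax∈ _ _
    (levelPos∧1∉⇒max∈ A levA) (levelPos∧1∉⇒max∈ B levB) eq

corollary3p5 : (k n : ℕ) → 1 ≤ k → 2 * k + 1 ≤ n →
    (A B : Subset n) → InVplus n k A → InVplus n k B →
    A ≢ B → core A ≢ core B
corollary3p5 k n 1≤k 2k+1≤n A B ((_ , indA) , levA) ((_ , indB) , levB) A≢B eq =
  A≢B (core-injective 3≤n A B indA levA indB levB eq)
  where
    3≤n : 3 ≤ n
    3≤n = ≤-trans (+-monoˡ-≤ 1 (*-monoʳ-≤ 2 1≤k)) 2k+1≤n
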